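{- Let $q$ be a prime power, $k\geq 2$ an integer and $r$ the smallest even integer $>2\log_q(k+1)$. Put $l=q^{r/2}$, $M_i=l^i(l^2-l)$, and $g_i=(l^{\frac{i+1}{2}}-1)^2$ for odd $i$, $g_i=(l^{\frac{i}{2}}-1)(l^{\frac{i+2}{2}}-1)$ for even $i$. Then the sequence $(\Delta_{q,k,i})_{i\in\mathbb{N}}$ with $\Delta_{q,k,i}=M_i-kg_i+k$ is increasing and $\lim_{i\to\infty}\Delta_{q,k,i}=+\infty$.
   Context: $g_i$ is the genus of the $i$-th step $F_i$ of the Garcia–Stichtenoth tower over $\mathbb{F}_{l^2}$ defined by $F_0=\mathbb{F}_{l^2}(x_0)$, $F_{i+1}=F_i(x_{i+1})$, $x_{i+1}^l+x_{i+1}=x_i^l/(x_i^{l-1}+1)$, and $M_i+2l$ (resp. $M_i+2l^2$) is its number of degree-one places in odd (resp. even) characteristic. -}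

module Defs where

open import Data.Nat as ℕ using (ℕ; zero; suc; _^_; _/_; _%_)
open import Data.Nat.Primality using (Prime)
open import Data.Integer as ℤ using (ℤ; +_; _-_; _*_; _+_)
open import Data.Product using (Σ; _×_)
open import Relation.Binary.PropositionalEquality using (_≡_)

IsPrimePower : ℕ → Set
IsPrimePower q = Σ ℕ λ p → Σ ℕ λ m → Prime p × (1 ℕ.≤ m) × (q ≡ p ^ m)

-- r is an even natural number with r > 2 log_q (k+1), i.e. k+1 < q^(r/2)
-- (for r = 2s and q ≥ 2:  2 log_q(k+1) < 2s  ⇔  k+1 < q^s)
EvenAbove : ℕ → ℕ → ℕ → Set
EvenAbove q k r = (r % 2 ≡ 0) × (suc k ℕ.< q ^ (r / 2))

IsSmallestEvenAbove : ℕ → ℕ → ℕ → Set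
IsSmallestEvenAbove q k r = EvenAbove q k r × (∀ r′ → EvenAbove q k r′ → r ℕ.≤ r′)

M : ℕ → ℕ → ℤ
M l i = + (l ^ i) * (+ (l ^ 2) - + l)

genus : ℕ → ℕ → ℤ
genus l i with i % 2
... | zero  = (+ (l ^ (i / 2)) - + 1) * (+ (l ^ ((i ℕ.+ 2) / 2)) - + 1)
... | suc _ = (+ (l ^ ((i ℕ.+ 1) / 2)) - + 1) * (+ (l ^ ((i ℕ.+ 1) / 2)) - + 1)

Δ : ℕ → ℕ → ℕ → ℕ → ℤ
Δ q k r i = M l i - + k * genus l i + + k
  where l = q ^ (r / 2)

{-# OPTIONS --safe #-}
module Submission where

-- Put U = l^⌊(i+1)/2⌋ and V = l^⌈(i+1)/2⌉, so that UV = l^(i+1). In both parities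
-- M_i = UV(l - 1) and g_i = (U - 1)(V - 1). Passing from i to i + 1 replaces (U, V)
-- by (V, lU), which raises Δ by (l - 1) U (V (l - 1 - k) + k), positive as soon as
-- l > k + 1. A strictly increasing integer sequence grows at least linearly, hence
-- exceeds every bound.

open import Defs
open import Data.Nat using (ℕ; suc)
open import Data.Integer using (ℤ; _<_)
open import Data.Product using (Σ; _×_)
import Data.Nat as N

open import Data.Nat using (zero; _^_; _/_; _%_; ⌊_/2⌋; ⌈_/2⌉; z≤n; s≤s; z<s; >-nonZero)
open import Data.Nat.DivMod using (m/n≡1+[m∸n]/n)
import Data.Nat.Properties as NP
open import Data.Integer using (+_; -[1+_]; 0ℤ; _+_; _-_; _*_; _≤_; ∣_∣; +<+; -≤+)
import Data.Integer.Properties as ZP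
open import Data.Integer.Tactic.RingSolver using (solve-∀)
open import Data.Product using (_,_)
open import Relation.Nullary using (¬_)
open import Relation.Binary.PropositionalEquality
  using (_≡_; refl; sym; trans; cong; cong₂; subst; module ≡-Reasoning)

n/2≡⌊n/2⌋ : ∀ n → n / 2 ≡ ⌊ n /2⌋
n/2≡⌊n/2⌋ zero          = refl
n/2≡⌊n/2⌋ (suc zero)    = refl
n/2≡⌊n/2⌋ (suc (suc n)) = trans (m/n≡1+[m∸n]/n {suc (suc n)} {2} (s≤s (s≤s z≤n))) (cong suc (n/2≡⌊n/2⌋ n))

[m+n]/2≡⌊n+m/2⌋ : ∀ m n → (m N.+ n) / 2 ≡ ⌊ n N.+ m /2⌋
[m+n]/2≡⌊n+m/2⌋ m n = trans (cong (_/ 2) (NP.+-comm m n)) (n/2≡⌊n/2⌋ (n N.+ m))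

even⇒⌊n/2⌋≡⌈n/2⌉ : ∀ n → n % 2 ≡ 0 → ⌊ n /2⌋ ≡ ⌈ n /2⌉
even⇒⌊n/2⌋≡⌈n/2⌉ zero          _    = refl
even⇒⌊n/2⌋≡⌈n/2⌉ (suc zero)    ()
even⇒⌊n/2⌋≡⌈n/2⌉ (suc (suc n)) even = cong suc (even⇒⌊n/2⌋≡⌈n/2⌉ n even)

odd⇒⌈n/2⌉≡1+⌊n/2⌋ : ∀ n → ¬ n % 2 ≡ 0 → ⌈ n /2⌉ ≡ suc ⌊ n /2⌋
odd⇒⌈n/2⌉≡1+⌊n/2⌋ zero          odd with () ← odd refl
odd⇒⌈n/2⌉≡1+⌊n/2⌋ (suc zero)    _   = refl
odd⇒⌈n/2⌉≡1+⌊n/2⌋ (suc (suc n)) odd = cong suc (odd⇒⌈n/2⌉≡1+⌊n/2⌋ n odd)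

m^⌊n/2⌋*m^⌈n/2⌉≡m^n : ∀ m n → m ^ ⌊ n /2⌋ N.* m ^ ⌈ n /2⌉ ≡ m ^ n
m^⌊n/2⌋*m^⌈n/2⌉≡m^n m n =
  trans (sym (NP.^-distribˡ-+-* m ⌊ n /2⌋ ⌈ n /2⌉)) (cong (m ^_) (NP.⌊n/2⌋+⌈n/2⌉≡n n))

Δpoly : ℤ → ℤ → ℤ → ℤ → ℤ
Δpoly L K U V = U * V * (L - + 1) - K * ((U - + 1) * (V - + 1)) + K

Δpoly-increment : ℤ → ℤ → ℤ → ℤ → ℤ
Δpoly-increment L K U V = (L - + 1) * U * (V * (L - + 1 - K) + K)

Δpoly-shift : ∀ L K U V → Δpoly L K V (L * U) ≡ Δpoly L K U V + Δpoly-increment L K U V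
Δpoly-shift = unfolded
  where
  -- solve-∀ does not unfold definitions.
  unfolded : ∀ L K U V →
    V * (L * U) * (L - + 1) - K * ((V - + 1) * (L * U - + 1)) + K
      ≡ U * V * (L - + 1) - K * ((U - + 1) * (V - + 1)) + K + (L - + 1) * U * (V * (L - + 1 - K) + K)
  unfolded = solve-∀

-- Writing l = k + 2 + t, the increment becomes (k + t + 1) u (v (t + 1) + k).
Δpoly-increment-pos : ∀ {k l u v} → suc k N.< l → 0 N.< u → 0 N.< v →
  0ℤ < Δpoly-increment (+ l) (+ k) (+ u) (+ v)
Δpoly-increment-pos {k} {u = suc u} {v = suc v} k+1<l _ _ with NP.m≤n⇒∃[o]m+o≡n k+1<l
... | t , refl = subst (λ d → 0ℤ < + suc (k N.+ t) * + suc u * (+ suc v * d + + k))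
                       (sym (cancel (+ k) (+ t))) (+<+ (s≤s z≤n))
  where
  cancel : ∀ K T → + 1 + K + T - K ≡ + 1 + T
  cancel = solve-∀

M-closed : ∀ l i → M l i ≡ + (l ^ ⌊ suc i /2⌋) * + (l ^ ⌈ suc i /2⌉) * (+ l - + 1)
M-closed l i = begin
  + (l ^ i) * (+ (l ^ 2) - + l)
    ≡⟨ cong (λ x → + (l ^ i) * (x - + l)) (trans (ZP.pos-* l _) (cong (+ l *_) (ZP.pos-* l 1))) ⟩
  + (l ^ i) * (+ l * (+ l * + 1) - + l)
    ≡⟨ factor (+ l) (+ (l ^ i)) ⟩
  + l * + (l ^ i) * (+ l - + 1)
    ≡⟨ cong (λ x → x * (+ l - + 1)) (sym (ZP.pos-* l (l ^ i))) ⟩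
  + (l ^ suc i) * (+ l - + 1)
    ≡⟨ cong (λ x → + x * (+ l - + 1)) (sym (m^⌊n/2⌋*m^⌈n/2⌉≡m^n l (suc i))) ⟩
  + (l ^ ⌊ suc i /2⌋ N.* l ^ ⌈ suc i /2⌉) * (+ l - + 1)
    ≡⟨ cong (_* (+ l - + 1)) (ZP.pos-* (l ^ ⌊ suc i /2⌋) (l ^ ⌈ suc i /2⌉)) ⟩
  + (l ^ ⌊ suc i /2⌋) * + (l ^ ⌈ suc i /2⌉) * (+ l - + 1) ∎
  where
  open ≡-Reasoning
  factor : ∀ L X → X * (L * (L * + 1) - L) ≡ L * X * (L - + 1)
  factor = solve-∀

genus-closed : ∀ l i →
  genus l i ≡ (+ (l ^ ⌊ suc i /2⌋) - + 1) * (+ (l ^ ⌈ suc i /2⌉) - + 1)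
genus-closed l i with i % 2 in parity
... | zero  = cong₂ (λ a b → (+ (l ^ a) - + 1) * (+ (l ^ b) - + 1))
                (trans (n/2≡⌊n/2⌋ i) (even⇒⌊n/2⌋≡⌈n/2⌉ i parity))
                ([m+n]/2≡⌊n+m/2⌋ i 2)
... | suc _ = cong₂ (λ a b → (+ (l ^ a) - + 1) * (+ (l ^ b) - + 1))
                ([m+n]/2≡⌊n+m/2⌋ i 1)
                (trans ([m+n]/2≡⌊n+m/2⌋ i 1) (odd⇒⌈n/2⌉≡1+⌊n/2⌋ i (λ even → NP.1+n≢0 (trans (sym parity) even))))

Δₗ : ℕ → ℕ → ℕ → ℤ
Δₗ l k i = M l i - + k * genus l i + + k

Δₗ-closed : ∀ l k i → Δₗ l k i ≡ Δpoly (+ l) (+ k) (+ (l ^ ⌊ suc i /2⌋)) (+ (l ^ ⌈ suc i /2⌉))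
Δₗ-closed l k i = cong₂ (λ m g → m - + k * g + + k) (M-closed l i) (genus-closed l i)

Δₗ-suc : ∀ l k i → let U = + (l ^ ⌊ suc i /2⌋) ; V = + (l ^ ⌈ suc i /2⌉) in
  Δₗ l k (suc i) ≡ Δₗ l k i + Δpoly-increment (+ l) (+ k) U V
Δₗ-suc l k i = begin
  Δₗ l k (suc i)                        ≡⟨ Δₗ-closed l k (suc i) ⟩
  Δpoly (+ l) (+ k) V (+ (l N.* l ^ a)) ≡⟨ cong (Δpoly (+ l) (+ k) V) (ZP.pos-* l (l ^ a)) ⟩
  Δpoly (+ l) (+ k) V (+ l * U)         ≡⟨ Δpoly-shift (+ l) (+ k) U V ⟩
  Δpoly (+ l) (+ k) U V + δ             ≡⟨ cong (_+ δ) (sym (Δₗ-closed l k i)) ⟩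
  Δₗ l k i + δ                          ∎
  where
  open ≡-Reasoning
  a = ⌊ suc i /2⌋
  U = + (l ^ a)
  V = + (l ^ ⌈ suc i /2⌉)
  δ = Δpoly-increment (+ l) (+ k) U V

Δₗ-increasing : ∀ {l k} → suc k N.< l → ∀ i → Δₗ l k i < Δₗ l k (suc i)
Δₗ-increasing {l} {k} k+1<l i = begin-strict
  Δₗ l k i       ≡⟨ sym (ZP.+-identityʳ (Δₗ l k i)) ⟩
  Δₗ l k i + 0ℤ  <⟨ ZP.+-monoʳ-< (Δₗ l k i) (Δpoly-increment-pos k+1<l (l^n>0 a) (l^n>0 b)) ⟩
  Δₗ l k i + δ   ≡⟨ sym (Δₗ-suc l k i) ⟩
  Δₗ l k (suc i) ∎
  where
  open ZP.≤-Reasoning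
  a = ⌊ suc i /2⌋
  b = ⌈ suc i /2⌉
  δ = Δpoly-increment (+ l) (+ k) (+ (l ^ a)) (+ (l ^ b))
  l^n>0 : ∀ n → 0 N.< l ^ n
  l^n>0 = NP.m^n>0 l {{>-nonZero (NP.<-trans z<s k+1<l)}}

i≤+∣i∣ : ∀ i → i ≤ + ∣ i ∣
i≤+∣i∣ (+ n)    = ZP.≤-refl
i≤+∣i∣ -[1+ n ] = -≤+

module StrictlyIncreasing (f : ℕ → ℤ) (f-inc : ∀ i → f i < f (suc i)) where

  f[0]+i≤f[i] : ∀ i → f 0 + + i ≤ f i
  f[0]+i≤f[i] zero    = ZP.≤-reflexive (ZP.+-identityʳ (f 0))
  f[0]+i≤f[i] (suc i) = begin
    f 0 + + suc i     ≡⟨ shift (f 0) (+ i) ⟩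
    + 1 + (f 0 + + i) ≤⟨ ZP.+-monoʳ-≤ (+ 1) (f[0]+i≤f[i] i) ⟩
    + 1 + f i         ≤⟨ ZP.i<j⇒suc[i]≤j (f-inc i) ⟩
    f (suc i)         ∎
    where
    open ZP.≤-Reasoning
    shift : ∀ x y → x + (+ 1 + y) ≡ + 1 + (x + y)
    shift = solve-∀

  unbounded : ∀ B → Σ ℕ λ N₀ → ∀ i → N₀ N.≤ i → B < f i
  unbounded B = suc ∣ B - f 0 ∣ , λ i N₀≤i → begin-strict
    B                      ≡⟨ split B (f 0) ⟩
    f 0 + (B - f 0)        ≤⟨ ZP.+-monoʳ-≤ (f 0) (i≤+∣i∣ (B - f 0)) ⟩
    f 0 + + ∣ B - f 0 ∣    <⟨ ZP.+-monoʳ-< (f 0) (+<+ N₀≤i) ⟩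
    f 0 + + i              ≤⟨ f[0]+i≤f[i] i ⟩
    f i                    ∎
    where
    open ZP.≤-Reasoning
    split : ∀ x y → x ≡ y + (x - y)
    split = solve-∀

-- Δ q k r is Δₗ (q ^ (r / 2)) k by definition.
lemma2 : (q k r : ℕ) → IsPrimePower q → 2 N.≤ k → IsSmallestEvenAbove q k r →
    ((i : ℕ) → Δ q k r i < Δ q k r (suc i))
    × ((B : ℤ) → Σ ℕ λ N₀ → (i : ℕ) → N₀ N.≤ i → B < Δ q k r i)
lemma2 q k r _ _ ((_ , k+1<l) , _) = increasing , StrictlyIncreasing.unbounded (Δ q k r) increasing
  where
  increasing : (i : ℕ) → Δ q k r i < Δ q k r (suc i)
  increasing = Δₗ-increasing k+1<l
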